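{- Let $S\subseteq\mathbb{Z}^+$ and $n,r\ge0$. If $1\notin S$, then ${n\brace 0}_{S,r}=r!\,{n\brace r}_{S-\vec{1}}$. If $1\in S$, then $$ {n\brace 0}_{S,r}=\sum_{i=0}^r (r)_i\,{n\brace i}_{(S\setminus\{1\})-\vec{1}}, $$ where $(r)_i=r(r-1)\cdots(r-i+1)$.
   Context: For $S\subseteq\mathbb{Z}^+$, ${n\brace k}_{S,r}$ is the number of set partitions of $[n+r]$ into $k+r$ non-empty blocks such that $1,\dots,r$ lie in distinct blocks and every block has size in $S$. For $T\subseteq\mathbb{Z}^+$, ${n\brace k}_T={n\brace k}_{T,0}$ is the number of partitions of $[n]$ into $k$ non-empty blocks with all block sizes in $T$. For a set $T$, $T-\vec{1}=\{t-1:t\in T\}$. -}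

module Defs where

open import Data.Bool using (Bool; true; false; _∧_; _∨_; not; if_then_else_)
open import Data.Nat using (ℕ; zero; suc; _+_; _*_; _∸_; _<ᵇ_; _≡ᵇ_)
open import Data.Fin using (Fin; zero; suc; toℕ)
open import Data.List using (List; []; _∷_; map; concatMap; allFin; length; filterᵇ)
open import Data.Bool.ListAction using (all; any)

SizeSet : Set
SizeSet = ℕ → Bool

-- S - 1 = { s - 1 : s ∈ S }  (t ∈ S - 1  iff  t + 1 ∈ S)
shift : SizeSet → SizeSet
shift S t = S (suc t)

remove1 : SizeSet → SizeSet
remove1 S t = S t ∧ not (t ≡ᵇ 1)

falling : ℕ → ℕ → ℕ
falling r zero    = 1
falling r (suc i) = falling r i * (r ∸ i)

extend : ∀ {m k} → Fin k → (Fin m → Fin k) → (Fin (suc m) → Fin k)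
extend j f zero    = j
extend j f (suc x) = f x

allFuns : (m k : ℕ) → List (Fin m → Fin k)
allFuns zero    k = (λ ()) ∷ []
allFuns (suc m) k = concatMap (λ f → map (λ j → extend j f) (allFin k)) (allFuns m k)

_==ᶠ_ : ∀ {k} → Fin k → Fin k → Bool
i ==ᶠ j = toℕ i ≡ᵇ toℕ j

_<ᶠ_ : ∀ {k l} → Fin k → Fin l → Bool
i <ᶠ j = toℕ i <ᵇ toℕ j

_⇒ᵇ_ : Bool → Bool → Bool
a ⇒ᵇ b = not a ∨ b

-- A set partition of [m] (here Fin m) into k blocks is encoded canonically by
-- its block-labelling f : Fin m → Fin k, where blocks are numbered 0,…,k-1 in
-- increasing order of their least elements.  This gives a bijection between
-- set partitions of [m] into k non-empty blocks and labellings f that are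
--   * surjective (every block is non-empty), and
--   * canonical: every label smaller than f x already occurs before x.
module _ {m k : ℕ} (f : Fin m → Fin k) where

  blockSize : Fin k → ℕ
  blockSize j = length (filterᵇ (λ x → f x ==ᶠ j) (allFin m))

  surjectiveᵇ : Bool
  surjectiveᵇ = all (λ j → any (λ x → f x ==ᶠ j) (allFin m)) (allFin k)

  canonicalᵇ : Bool
  canonicalᵇ = all (λ x → all (λ j → (j <ᶠ f x) ⇒ᵇ any (λ y → (y <ᶠ x) ∧ (f y ==ᶠ j)) (allFin m)) (allFin k)) (allFin m)

  sizesInᵇ : SizeSet → Bool
  sizesInᵇ S = all (λ j → S (blockSize j)) (allFin k)

  -- the elements 1,…,r (here 0,…,r-1) lie in distinct blocks
  distinctFirstᵇ : ℕ → Bool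
  distinctFirstᵇ r = all (λ x → all (λ y → ((toℕ x <ᵇ r) ∧ (toℕ y <ᵇ r) ∧ not (x ==ᶠ y)) ⇒ᵇ not (f x ==ᶠ f y)) (allFin m)) (allFin m)

  isSPartitionᵇ : SizeSet → ℕ → Bool
  isSPartitionᵇ S r = surjectiveᵇ ∧ canonicalᵇ ∧ sizesInᵇ S ∧ distinctFirstᵇ r

-- {n brace k}_{S,r}: number of set partitions of [n+r] into k+r non-empty blocks,
-- with 1,…,r in distinct blocks and all block sizes in S.
rStirlingS : SizeSet → ℕ → ℕ → ℕ → ℕ
rStirlingS S r n k = length (filterᵇ (λ f → isSPartitionᵇ f S r) (allFuns (n + r) (k + r)))

stirlingS : SizeSet → ℕ → ℕ → ℕ
stirlingS T n k = rStirlingS T 0 n k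

module Submission where

-- Idea.  In a partition of [r + n] into r blocks with 1, …, r in distinct blocks, the canonical
-- labelling gives the point y ≤ r the label y; so the partition is the same as the map
-- h : [n] → [r] sending each other point to its block, and it is counted iff every fibre of h,
-- enlarged by one point, has size in S ("h is admissible").  Every h factors uniquely as
-- h = ι ∘ g, with g : [n] → [i] the canonical labelling of the partition of [n] into the non-empty
-- fibres of h and ι : [i] → [r] injective.  Then h is admissible iff g has block sizes in
-- (S ∖ {1}) − 1 and either 1 ∈ S (empty fibres become singleton blocks) or i = r.  Counting the
-- pairs (g, ι) gives {n brace i}_{(S∖{1})−1} · (r)_i for each i ≤ r.

open import Defs
open import Data.Bool using (Bool; true; false; _∧_; _∨_; not; T)
open import Data.Bool.Properties using (T-∧; T-∨; ∧-zeroʳ; ∧-identityʳ)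
open import Data.Bool.ListAction using (all; any; and)
open import Data.Nat using (ℕ; zero; suc; _+_; _*_; _∸_; _≡ᵇ_; _<ᵇ_; _<_; _≤_; z≤n; s≤s; _!)
open import Data.Nat.Properties
  using (+-identityʳ; +-assoc; +-comm; +-commutativeSemigroup; *-zeroʳ; *-identityˡ; *-identityʳ; *-comm;
         *-assoc; *-distribˡ-+; m+n∸n≡m; m≤m+n; m≤n+m; ≤-reflexive; ≤-trans; ≤-antisym; <-irrefl;
         <-trans; ≮⇒≥; <⇒≱; n<1+n; ≡ᵇ⇒≡; ≡⇒≡ᵇ; <ᵇ⇒<; <⇒<ᵇ)
open import Data.Nat.ListAction using (sum)
open import Data.Nat.ListAction.Properties using (sum-++)
open import Data.Fin using (Fin; zero; suc; toℕ; fromℕ; fromℕ<; inject₁; punchOut; _↑ˡ_; _↑ʳ_; splitAt)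
import Data.Fin as Fin
open import Data.Fin.Induction using (<-wellFounded)
open import Induction.WellFounded using (Acc; acc)
open import Data.Fin.Properties
  using (toℕ-injective; toℕ-fromℕ<; toℕ-fromℕ; toℕ-inject₁; toℕ-↑ˡ; toℕ-↑ʳ; toℕ<n; suc-injective;
         ↑ˡ-injective; splitAt-↑ˡ; splitAt-↑ʳ; injective⇒≤; punchOut-injective; any?)
  renaming (_≟_ to _≟ᶠ_)
open import Data.List
  using (List; []; _∷_; _++_; map; concatMap; length; filterᵇ; tabulate; allFin; applyUpTo; upTo)
open import Data.List.Properties using (map-++; map-∘; map-cong; map-tabulate; length-tabulate)
open import Data.List.Relation.Unary.All.Properties using (all⁺; all⁻)
open import Data.List.Relation.Unary.Any.Properties using (any⁺; any⁻)
import Data.List.Relation.Unary.All as All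
open import Data.List.Relation.Unary.Any using (satisfied)
open import Data.List.Membership.Propositional using (lose)
open import Data.List.Membership.Propositional.Properties using (∈-allFin)
open import Data.Product using (_×_; _,_; proj₁; proj₂; ∃)
open import Data.Sum using (_⊎_; inj₁; inj₂; [_,_]′)
open import Data.Empty using (⊥; ⊥-elim)
open import Function using (_∘_; id; _⇔_; mk⇔; Equivalence)
open import Relation.Nullary using (¬_; yes; no)
open import Relation.Nullary.Decidable using (T?; decidable-stable)
open import Function.Definitions using (Injective)
open import Relation.Binary.PropositionalEquality
  using (_≡_; _≢_; _≗_; refl; sym; trans; cong; cong₂; subst; subst₂; module ≡-Reasoning)
open import Algebra.Properties.CommutativeSemigroup +-commutativeSemigroup using (interchange)

open Equivalence using (to; from)

∑ : {A : Set} → List A → (A → ℕ) → ℕ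
∑ xs f = sum (map f xs)

syntax ∑ xs (λ x → e) = ∑[ x ← xs ] e

ind : Bool → ℕ
ind true  = 1
ind false = 0

ind-true : ∀ {b} → T b → ind b ≡ 1
ind-true {true} _ = refl

ind-false : ∀ {b} → ¬ T b → ind b ≡ 0
ind-false {false} _ = refl
ind-false {true}  t = ⊥-elim (t _)

ind-∧ : ∀ a b → ind (a ∧ b) ≡ ind a * ind b
ind-∧ true  b = sym (+-identityʳ (ind b))
ind-∧ false b = refl

ind-not : ∀ b → ind (not b) + ind b ≡ 1
ind-not true  = refl
ind-not false = refl

ind-*-cong : ∀ b {x y} → (T b → x ≡ y) → ind b * x ≡ ind b * y
ind-*-cong true  e = cong (_+ 0) (e _)
ind-*-cong false e = refl

T-ext : ∀ {a b} → (T a → T b) → (T b → T a) → a ≡ b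
T-ext {true}  {true}  _ _ = refl
T-ext {true}  {false} f _ = ⊥-elim (f _)
T-ext {false} {true}  _ g = ⊥-elim (g _)
T-ext {false} {false} _ _ = refl

variable
  A B : Set

∑-cong : ∀ (xs : List A) {f g : A → ℕ} → (∀ x → f x ≡ g x) → ∑ xs f ≡ ∑ xs g
∑-cong xs e = cong sum (map-cong e xs)

∑-vanish : ∀ (xs : List A) {f : A → ℕ} → (∀ x → f x ≡ 0) → ∑ xs f ≡ 0
∑-vanish []       e = refl
∑-vanish (x ∷ xs) e = cong₂ _+_ (e x) (∑-vanish xs e)

∑-++ : ∀ (xs ys : List A) (f : A → ℕ) → ∑ (xs ++ ys) f ≡ ∑ xs f + ∑ ys f
∑-++ xs ys f = trans (cong sum (map-++ f xs ys)) (sum-++ (map f xs) (map f ys))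

∑-+ : ∀ (xs : List A) (f g : A → ℕ) → ∑[ x ← xs ] (f x + g x) ≡ ∑ xs f + ∑ xs g
∑-+ []       f g = refl
∑-+ (x ∷ xs) f g = trans (cong (f x + g x +_) (∑-+ xs f g)) (interchange (f x) (g x) _ _)

∑-*ˡ : ∀ (xs : List A) c (f : A → ℕ) → ∑[ x ← xs ] (c * f x) ≡ c * ∑ xs f
∑-*ˡ []       c f = sym (*-zeroʳ c)
∑-*ˡ (x ∷ xs) c f = trans (cong (c * f x +_) (∑-*ˡ xs c f)) (sym (*-distribˡ-+ c (f x) _))

∑-*ʳ : ∀ (xs : List A) c (f : A → ℕ) → ∑[ x ← xs ] (f x * c) ≡ ∑ xs f * c
∑-*ʳ xs c f = trans (∑-cong xs (λ x → *-comm (f x) c)) (trans (∑-*ˡ xs c f) (*-comm c _))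

∑-swap : ∀ (xs : List A) (ys : List B) (f : A → B → ℕ) →
         ∑[ x ← xs ] ∑[ y ← ys ] f x y ≡ ∑[ y ← ys ] ∑[ x ← xs ] f x y
∑-swap []       ys f = sym (∑-vanish ys (λ _ → refl))
∑-swap (x ∷ xs) ys f =
  trans (cong (∑ ys (f x) +_) (∑-swap xs ys f)) (sym (∑-+ ys (f x) (λ y → ∑[ x′ ← xs ] f x′ y)))

∑-map : ∀ (g : B → A) (ys : List B) (f : A → ℕ) → ∑ (map g ys) f ≡ ∑ ys (f ∘ g)
∑-map g ys f = cong sum (sym (map-∘ {g = f} {f = g} ys))

∑-concatMap : ∀ (G : B → List A) (ys : List B) (f : A → ℕ) →
              ∑ (concatMap G ys) f ≡ ∑[ y ← ys ] ∑ (G y) f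
∑-concatMap G []       f = refl
∑-concatMap G (y ∷ ys) f =
  trans (∑-++ (G y) (concatMap G ys) f) (cong (∑ (G y) f +_) (∑-concatMap G ys f))

length-filterᵇ : ∀ (p : A → Bool) (xs : List A) → length (filterᵇ p xs) ≡ ∑ xs (ind ∘ p)
length-filterᵇ p []       = refl
length-filterᵇ p (x ∷ xs) with p x
... | true  = cong suc (length-filterᵇ p xs)
... | false = length-filterᵇ p xs

∑-not : ∀ (xs : List A) (b : A → Bool) → ∑[ x ← xs ] ind (not (b x)) + ∑ xs (ind ∘ b) ≡ length xs
∑-not []       b = refl
∑-not (x ∷ xs) b = begin
  ind (not (b x)) + ∑[ y ← xs ] ind (not (b y)) + (ind (b x) + ∑ xs (ind ∘ b))
    ≡⟨ interchange (ind (not (b x))) _ (ind (b x)) _ ⟩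
  (ind (not (b x)) + ind (b x)) + (∑[ y ← xs ] ind (not (b y)) + ∑ xs (ind ∘ b))
    ≡⟨ cong₂ _+_ (ind-not (b x)) (∑-not xs b) ⟩
  suc (length xs) ∎
  where open ≡-Reasoning

∑-tabulate : ∀ {n} (G : Fin n → A) (f : A → ℕ) → ∑ (tabulate G) f ≡ ∑ (allFin n) (f ∘ G)
∑-tabulate G f = cong sum (trans (map-tabulate G f) (sym (map-tabulate id (f ∘ G))))

∑-allFin-suc : ∀ {n} (f : Fin (suc n) → ℕ) → ∑ (allFin (suc n)) f ≡ f zero + ∑ (allFin n) (f ∘ suc)
∑-allFin-suc f = cong (f zero +_) (∑-tabulate suc f)

∑-allFin-+ : ∀ r n (f : Fin (r + n) → ℕ) →
             ∑ (allFin (r + n)) f ≡ ∑[ y ← allFin r ] f (y ↑ˡ n) + ∑[ z ← allFin n ] f (r ↑ʳ z)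
∑-allFin-+ zero    n f = refl
∑-allFin-+ (suc r) n f = begin
  ∑ (allFin (suc r + n)) f                                    ≡⟨ ∑-allFin-suc f ⟩
  f zero + ∑ (allFin (r + n)) (f ∘ suc)                       ≡⟨ cong (f zero +_) (∑-allFin-+ r n (f ∘ suc)) ⟩
  f zero + (∑[ y ← allFin r ] f (suc y ↑ˡ n) + ∑[ z ← allFin n ] f (suc r ↑ʳ z))
                                                              ≡⟨ sym (+-assoc (f zero) _ _) ⟩
  f zero + ∑[ y ← allFin r ] f (suc y ↑ˡ n) + ∑[ z ← allFin n ] f (suc r ↑ʳ z)
                                                              ≡⟨ cong (_+ ∑[ z ← allFin n ] f (suc r ↑ʳ z))
                                                                      (sym (∑-allFin-suc (λ y → f (y ↑ˡ n)))) ⟩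
  ∑[ y ← allFin (suc r) ] f (y ↑ˡ n) + ∑[ z ← allFin n ] f (suc r ↑ʳ z) ∎
  where open ≡-Reasoning

∑-upTo : ∀ m (f : ℕ → ℕ) → ∑ (upTo m) f ≡ ∑[ i ← allFin m ] f (toℕ i)
∑-upTo m f = go m id
  where
  go : ∀ m (g : ℕ → ℕ) → ∑ (applyUpTo g m) f ≡ ∑[ i ← allFin m ] f (g (toℕ i))
  go zero    g = refl
  go (suc m) g = trans (cong (f (g 0) +_) (go m (g ∘ suc))) (sym (∑-allFin-suc {m} (λ i → f (g (toℕ i)))))

∑-const-1 : ∀ (xs : List A) → ∑[ x ← xs ] 1 ≡ length xs
∑-const-1 []       = refl
∑-const-1 (x ∷ xs) = cong suc (∑-const-1 xs)

∑-only : ∀ {k} (c : Fin k) (f : Fin k → ℕ) → (∀ j → j ≢ c → f j ≡ 0) → ∑ (allFin k) f ≡ f c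
∑-only {suc k} zero    f z = begin
  ∑ (allFin (suc k)) f           ≡⟨ ∑-allFin-suc f ⟩
  f zero + ∑ (allFin k) (f ∘ suc) ≡⟨ cong (f zero +_) (∑-vanish (allFin k) (λ j → z (suc j) λ ())) ⟩
  f zero + 0                      ≡⟨ +-identityʳ (f zero) ⟩
  f zero                          ∎
  where open ≡-Reasoning
∑-only {suc k} (suc c) f z = begin
  ∑ (allFin (suc k)) f            ≡⟨ ∑-allFin-suc f ⟩
  f zero + ∑ (allFin k) (f ∘ suc)
    ≡⟨ cong₂ _+_ (z zero λ ()) (∑-only c (f ∘ suc) (λ j j≢c → z (suc j) (j≢c ∘ suc-injective))) ⟩
  f (suc c)                       ∎
  where open ≡-Reasoning

∑-point : ∀ {k} (c : Fin k) (t : Fin k → Bool) → (∀ j → T (t j) ⇔ j ≡ c) → ∑ (allFin k) (ind ∘ t) ≡ 1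
∑-point c t t⇔c = trans (∑-only c (ind ∘ t) (λ j j≢c → ind-false (j≢c ∘ to (t⇔c j))))
                        (ind-true (from (t⇔c c) refl))

∑-only-upTo : ∀ {m c} → c < m → (f : ℕ → ℕ) → (∀ i → i ≢ c → f i ≡ 0) → ∑ (upTo m) f ≡ f c
∑-only-upTo {m} {c} c<m f z = begin
  ∑ (upTo m) f                   ≡⟨ ∑-upTo m f ⟩
  ∑[ i ← allFin m ] f (toℕ i)    ≡⟨ ∑-only (fromℕ< c<m) (f ∘ toℕ) (λ i i≢c → z (toℕ i) (i≢c ∘ fromℕ<-unique i)) ⟩
  f (toℕ (fromℕ< c<m))           ≡⟨ cong f (toℕ-fromℕ< c<m) ⟩
  f c                            ∎
  where
  open ≡-Reasoning
  fromℕ<-unique : ∀ i → toℕ i ≡ c → i ≡ fromℕ< c<m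
  fromℕ<-unique i eq = toℕ-injective (trans eq (sym (toℕ-fromℕ< c<m)))

T-all-allFin : ∀ {n} (p : Fin n → Bool) → T (all p (allFin n)) ⇔ (∀ i → T (p i))
T-all-allFin {n} p = mk⇔ (λ t i → All.lookup (all⁺ p (allFin n) t) (∈-allFin i))
                         (λ h → all⁻ p {xs = allFin n} (All.tabulate (λ {i} _ → h i)))

T-any-allFin : ∀ {n} (p : Fin n → Bool) → T (any p (allFin n)) ⇔ ∃ (λ i → T (p i))
T-any-allFin {n} p = mk⇔ (λ t → satisfied (any⁻ p (allFin n) t))
                         (λ (i , pi) → any⁺ p (lose (∈-allFin i) pi))

T-==ᶠ : ∀ {k} {i j : Fin k} → T (i ==ᶠ j) ⇔ i ≡ j
T-==ᶠ {i = i} {j} = mk⇔ (λ t → toℕ-injective (≡ᵇ⇒≡ (toℕ i) (toℕ j) t))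
                         (λ i≡j → ≡⇒≡ᵇ (toℕ i) (toℕ j) (cong toℕ i≡j))

T-<ᶠ : ∀ {k l} {i : Fin k} {j : Fin l} → T (i <ᶠ j) ⇔ toℕ i < toℕ j
T-<ᶠ {i = i} {j} = mk⇔ (<ᵇ⇒< (toℕ i) (toℕ j)) (<⇒<ᵇ {toℕ i} {toℕ j})

T-not : ∀ {b} → T (not b) ⇔ (¬ T b)
T-not {true}  = mk⇔ (λ ()) (λ ¬t → ¬t _)
T-not {false} = mk⇔ (λ _ ()) (λ _ → _)

T-⇒ᵇ : ∀ {a b} → T (a ⇒ᵇ b) ⇔ (T a → T b)
T-⇒ᵇ {true}  = mk⇔ (λ t _ → t) (λ f → f _)
T-⇒ᵇ {false} = mk⇔ (λ _ ()) (λ _ → _)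

Fun : ℕ → ℕ → Set
Fun m k = Fin m → Fin k

infix 4 _≗ᵇ_
_≗ᵇ_ : ∀ {m k} → Fun m k → Fun m k → Bool
f ≗ᵇ g = all (λ x → f x ==ᶠ g x) (allFin _)

T-≗ᵇ : ∀ {m k} {f g : Fun m k} → T (f ≗ᵇ g) ⇔ f ≗ g
T-≗ᵇ {f = f} {g} = mk⇔ (λ t x → to T-==ᶠ (to (T-all-allFin _) t x))
                        (λ f≗g → from (T-all-allFin _) (λ x → from T-==ᶠ (f≗g x)))

extend-≗ : ∀ {m k} (j : Fin k) (f : Fun m k) (F : Fun (suc m) k) →
           extend j f ≗ F ⇔ (j ≡ F zero × f ≗ F ∘ suc)
extend-≗ j f F = mk⇔ (λ e → e zero , e ∘ suc) λ { (j≡ , f≗) zero → j≡ ; (j≡ , f≗) (suc x) → f≗ x }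

∑-allFuns-suc : ∀ m k (F : Fun (suc m) k → ℕ) →
                ∑ (allFuns (suc m) k) F ≡ ∑[ f ← allFuns m k ] ∑[ j ← allFin k ] F (extend j f)
∑-allFuns-suc m k F = trans (∑-concatMap _ (allFuns m k) F)
                            (∑-cong (allFuns m k) (λ f → ∑-map (λ j → extend j f) (allFin k) F))

∑-≗ᵇ : ∀ m k (F : Fun m k) → ∑[ h ← allFuns m k ] ind (h ≗ᵇ F) ≡ 1
∑-≗ᵇ zero    k F = refl
∑-≗ᵇ (suc m) k F = begin
  ∑[ h ← allFuns (suc m) k ] ind (h ≗ᵇ F)                          ≡⟨ ∑-allFuns-suc m k _ ⟩
  ∑[ f ← allFuns m k ] ∑[ j ← allFin k ] ind (extend j f ≗ᵇ F)      ≡⟨ ∑-cong (allFuns m k) first-value ⟩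
  ∑[ f ← allFuns m k ] ind (f ≗ᵇ F ∘ suc)                           ≡⟨ ∑-≗ᵇ m k (F ∘ suc) ⟩
  1                                                                ∎
  where
  open ≡-Reasoning
  first-value : ∀ f → ∑[ j ← allFin k ] ind (extend j f ≗ᵇ F) ≡ ind (f ≗ᵇ F ∘ suc)
  first-value f = trans (∑-only (F zero) _ (λ j j≢ → ind-false (j≢ ∘ proj₁ ∘ to (extend-≗ j f F) ∘ to T-≗ᵇ)))
    (cong ind (T-ext (λ t → from T-≗ᵇ (proj₂ (to (extend-≗ (F zero) f F) (to T-≗ᵇ t))))
                     (λ t → from T-≗ᵇ (from (extend-≗ (F zero) f F) (refl , to T-≗ᵇ t)))))

∑-unique : ∀ {m k} (F : Fun m k) (q : Bool) (t : Fun m k → Bool) →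
           (∀ h → T (t h) → T q × h ≗ F) → (T q → ∀ h → h ≗ F → T (t h)) →
           ∑ (allFuns m k) (ind ∘ t) ≡ ind q
∑-unique {m} {k} F true  t sound complete =
  trans (∑-cong (allFuns m k) (λ h → cong ind (T-ext (λ th → from T-≗ᵇ (proj₂ (sound h th)))
                                                     (complete _ h ∘ to T-≗ᵇ))))
        (∑-≗ᵇ m k F)
∑-unique {m} {k} F false t sound complete = ∑-vanish (allFuns m k) (λ h → ind-false (proj₁ ∘ sound h))

injectiveᵇ : ∀ {i r} → Fun i r → Bool
injectiveᵇ ι = all (λ x → all (λ y → (ι x ==ᶠ ι y) ⇒ᵇ (x ==ᶠ y)) (allFin _)) (allFin _)

T-injectiveᵇ : ∀ {i r} {ι : Fun i r} → T (injectiveᵇ ι) ⇔ Injective _≡_ _≡_ ι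
T-injectiveᵇ {i} {ι = ι} = mk⇔ sound complete
  where
  agree : Fin i → Fin i → Bool
  agree x y = (ι x ==ᶠ ι y) ⇒ᵇ (x ==ᶠ y)
  sound : T (injectiveᵇ ι) → Injective _≡_ _≡_ ι
  sound t {x} {y} e = to T-==ᶠ (to T-⇒ᵇ (to (T-all-allFin (agree x))
                        (to (T-all-allFin (λ x → all (agree x) (allFin i))) t x) y) (from T-==ᶠ e))
  complete : Injective _≡_ _≡_ ι → T (injectiveᵇ ι)
  complete inj = from (T-all-allFin (λ x → all (agree x) (allFin i))) λ x →
                 from (T-all-allFin (agree x)) λ y → from T-⇒ᵇ (from T-==ᶠ ∘ inj ∘ to T-==ᶠ)

inImageᵇ : ∀ {i r} → Fin r → Fun i r → Bool
inImageᵇ j f = any (λ x → f x ==ᶠ j) (allFin _)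

T-inImageᵇ : ∀ {i r} {j : Fin r} {f : Fun i r} → T (inImageᵇ j f) ⇔ ∃ (λ x → f x ≡ j)
T-inImageᵇ = mk⇔ (λ t → let (x , fx) = to (T-any-allFin _) t in x , to T-==ᶠ fx)
                  (λ (x , fx≡j) → from (T-any-allFin _) (x , from T-==ᶠ fx≡j))

extend-injective : ∀ {i r} (j : Fin r) (f : Fun i r) →
                   Injective _≡_ _≡_ (extend j f) ⇔ (Injective _≡_ _≡_ f × ¬ ∃ (λ x → f x ≡ j))
extend-injective j f = mk⇔ restrict injective-extend
  where
  zero≢suc : ∀ {n} {x : Fin n} → zero ≢ suc x
  zero≢suc ()
  restrict : Injective _≡_ _≡_ (extend j f) → Injective _≡_ _≡_ f × ¬ ∃ (λ x → f x ≡ j)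
  restrict inj = (λ e → suc-injective (inj e)) , (λ (x , fx≡j) → zero≢suc (inj (sym fx≡j)))
  injective-extend : Injective _≡_ _≡_ f × ¬ ∃ (λ x → f x ≡ j) →
                     Injective _≡_ _≡_ (extend j f)
  injective-extend (inj , miss) {zero}  {zero}  _ = refl
  injective-extend (inj , miss) {zero}  {suc y} e = ⊥-elim (miss (y , sym e))
  injective-extend (inj , miss) {suc x} {zero}  e = ⊥-elim (miss (x , e))
  injective-extend (inj , miss) {suc x} {suc y} e = cong suc (inj e)

injectiveᵇ-extend : ∀ {i r} (j : Fin r) (f : Fun i r) →
                    injectiveᵇ (extend j f) ≡ injectiveᵇ f ∧ not (inImageᵇ j f)
injectiveᵇ-extend j f = T-ext
  (λ t → let (inj , miss) = to (extend-injective j f) (to T-injectiveᵇ t)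
         in from T-∧ (from T-injectiveᵇ inj , from T-not (miss ∘ to T-inImageᵇ)))
  (λ t → let (inj , miss) = to T-∧ t
         in from T-injectiveᵇ (from (extend-injective j f)
              (to T-injectiveᵇ inj , to T-not miss ∘ from T-inImageᵇ)))

ind-any-atMostOne : ∀ {n} (q : Fin n → Bool) → (∀ x y → T (q x) → T (q y) → x ≡ y) →
                    ind (any q (allFin n)) ≡ ∑ (allFin n) (ind ∘ q)
ind-any-atMostOne {n} q unique with any? (λ x → T? (q x))
... | yes (x , qx) = begin
  ind (any q (allFin n))   ≡⟨ ind-true (from (T-any-allFin q) (x , qx)) ⟩
  1                        ≡⟨ sym (ind-true qx) ⟩
  ind (q x)                ≡⟨ sym (∑-only x (ind ∘ q) (λ y y≢x → ind-false (λ qy → y≢x (unique y x qy qx)))) ⟩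
  ∑ (allFin n) (ind ∘ q)   ∎
  where open ≡-Reasoning
... | no none = trans (ind-false (none ∘ to (T-any-allFin q)))
                      (sym (∑-vanish (allFin n) (λ x → ind-false (λ qx → none (x , qx)))))

image-size : ∀ {i r} (f : Fun i r) → Injective _≡_ _≡_ f → ∑[ j ← allFin r ] ind (inImageᵇ j f) ≡ i
image-size {i} {r} f inj = begin
  ∑[ j ← allFin r ] ind (inImageᵇ j f)
    ≡⟨ ∑-cong (allFin r) (λ j → ind-any-atMostOne _ (at-most-one j)) ⟩
  ∑[ j ← allFin r ] ∑[ x ← allFin i ] ind (f x ==ᶠ j)
    ≡⟨ ∑-swap (allFin r) (allFin i) _ ⟩
  ∑[ x ← allFin i ] ∑[ j ← allFin r ] ind (f x ==ᶠ j)
    ≡⟨ ∑-cong (allFin i) (λ x → ∑-point (f x) _ (λ j → ==ᶠ-flip)) ⟩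
  ∑[ x ← allFin i ] 1
    ≡⟨ trans (∑-const-1 (allFin i)) (length-tabulate id) ⟩
  i ∎
  where
  open ≡-Reasoning
  at-most-one : ∀ j x y → T (f x ==ᶠ j) → T (f y ==ᶠ j) → x ≡ y
  at-most-one j x y fx≡j fy≡j = inj (trans (to T-==ᶠ fx≡j) (sym (to T-==ᶠ fy≡j)))
  ==ᶠ-flip : ∀ {k} {c j : Fin k} → T (c ==ᶠ j) ⇔ j ≡ c
  ==ᶠ-flip = mk⇔ (sym ∘ to T-==ᶠ) (from T-==ᶠ ∘ sym)

nonimage-size : ∀ {i r} (f : Fun i r) → Injective _≡_ _≡_ f →
                ∑[ j ← allFin r ] ind (not (inImageᵇ j f)) ≡ r ∸ i
nonimage-size {i} {r} f inj = begin
  missed                                          ≡⟨ sym (m+n∸n≡m missed i) ⟩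
  missed + i ∸ i                                  ≡⟨ cong (λ t → missed + t ∸ i) (sym (image-size f inj)) ⟩
  missed + ∑[ j ← allFin r ] ind (inImageᵇ j f) ∸ i ≡⟨ cong (_∸ i) (∑-not (allFin r) (λ j → inImageᵇ j f)) ⟩
  length (allFin r) ∸ i                           ≡⟨ cong (_∸ i) (length-tabulate id) ⟩
  r ∸ i                                           ∎
  where
  open ≡-Reasoning
  missed : ℕ
  missed = ∑[ j ← allFin r ] ind (not (inImageᵇ j f))

count-injections : ∀ i r → ∑ (allFuns i r) (ind ∘ injectiveᵇ) ≡ falling r i
count-injections zero    r = refl
count-injections (suc i) r = begin
  ∑ (allFuns (suc i) r) (ind ∘ injectiveᵇ)                                ≡⟨ ∑-allFuns-suc i r _ ⟩
  ∑[ f ← allFuns i r ] ∑[ j ← allFin r ] ind (injectiveᵇ (extend j f))    ≡⟨ ∑-cong (allFuns i r) extensions ⟩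
  ∑[ f ← allFuns i r ] (ind (injectiveᵇ f) * (r ∸ i))                     ≡⟨ ∑-*ʳ (allFuns i r) (r ∸ i) _ ⟩
  ∑ (allFuns i r) (ind ∘ injectiveᵇ) * (r ∸ i)
    ≡⟨ cong (_* (r ∸ i)) (count-injections i r) ⟩
  falling r i * (r ∸ i)                                                   ∎
  where
  open ≡-Reasoning
  -- an injective f extends injectively by each of the r ∸ i points it misses
  extensions : ∀ f → ∑[ j ← allFin r ] ind (injectiveᵇ (extend j f)) ≡ ind (injectiveᵇ f) * (r ∸ i)
  extensions f = begin
    ∑[ j ← allFin r ] ind (injectiveᵇ (extend j f))
      ≡⟨ ∑-cong (allFin r) (λ j → trans (cong ind (injectiveᵇ-extend j f)) (ind-∧ (injectiveᵇ f) _)) ⟩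
    ∑[ j ← allFin r ] (ind (injectiveᵇ f) * ind (not (inImageᵇ j f)))
      ≡⟨ ∑-*ˡ (allFin r) (ind (injectiveᵇ f)) _ ⟩
    ind (injectiveᵇ f) * ∑[ j ← allFin r ] ind (not (inImageᵇ j f))
      ≡⟨ ind-*-cong (injectiveᵇ f) (nonimage-size f ∘ to T-injectiveᵇ) ⟩
    ind (injectiveᵇ f) * (r ∸ i) ∎

module _ {m k : ℕ} (f : Fun m k) where

  Surjective : Set
  Surjective = ∀ j → ∃ λ x → f x ≡ j

  Canonical : Set
  Canonical = ∀ x j → toℕ j < toℕ (f x) → ∃ λ y → toℕ y < toℕ x × f y ≡ j

  SizesIn : SizeSet → Set
  SizesIn S = ∀ j → T (S (blockSize f j))

  DistinctFirst : ℕ → Set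
  DistinctFirst r = ∀ {x y} → toℕ x < r → toℕ y < r → f x ≡ f y → x ≡ y

record IsSPartition {m k} (f : Fun m k) (S : SizeSet) (r : ℕ) : Set where
  field
    surjective    : Surjective f
    canonical     : Canonical f
    sizesIn       : SizesIn f S
    distinctFirst : DistinctFirst f r

T-isSPartitionᵇ : ∀ {m k} (f : Fun m k) S r → T (isSPartitionᵇ f S r) ⇔ IsSPartition f S r
T-isSPartitionᵇ {m} {k} f S r = mk⇔ sound complete
  where
  open IsSPartition
  used : Fin k → Bool
  used j = any (λ x → f x ==ᶠ j) (allFin m)
  usedBefore : Fin m → Fin k → Bool
  usedBefore x j = any (λ y → (y <ᶠ x) ∧ (f y ==ᶠ j)) (allFin m)
  canonicalAt : Fin m → Bool
  canonicalAt x = all (λ j → (j <ᶠ f x) ⇒ᵇ usedBefore x j) (allFin k)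
  separated : Fin m → Fin m → Bool
  separated x y = ((toℕ x <ᵇ r) ∧ (toℕ y <ᵇ r) ∧ not (x ==ᶠ y)) ⇒ᵇ not (f x ==ᶠ f y)
  separatedAt : Fin m → Bool
  separatedAt x = all (separated x) (allFin m)

  T-surjective : T (surjectiveᵇ f) ⇔ Surjective f
  T-surjective = mk⇔
    (λ t j → let (x , fx) = to (T-any-allFin _) (to (T-all-allFin used) t j) in x , to T-==ᶠ fx)
    (λ s → from (T-all-allFin used) λ j → let (x , fx≡j) = s j in from (T-any-allFin _) (x , from T-==ᶠ fx≡j))

  T-canonical : T (canonicalᵇ f) ⇔ Canonical f
  T-canonical = mk⇔
    (λ t x j j< → let (y , below) = to (T-any-allFin _) (to T-⇒ᵇ (to (T-all-allFin _)
                                      (to (T-all-allFin canonicalAt) t x) j) (from T-<ᶠ j<))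
                      (y<x , fy) = to T-∧ below
                  in y , to T-<ᶠ y<x , to T-==ᶠ fy)
    (λ c → from (T-all-allFin canonicalAt) λ x → from (T-all-allFin _) λ j → from T-⇒ᵇ λ j< →
       let (y , y<x , fy≡j) = c x j (to T-<ᶠ j<)
       in from (T-any-allFin _) (y , from T-∧ (from T-<ᶠ y<x , from T-==ᶠ fy≡j)))

  T-distinctFirst : T (distinctFirstᵇ f r) ⇔ DistinctFirst f r
  T-distinctFirst = mk⇔
    (λ t {x} {y} x<r y<r fx≡fy → decidable-stable (x ≟ᶠ y) λ x≢y →
       to T-not (to T-⇒ᵇ (to (T-all-allFin (separated x)) (to (T-all-allFin separatedAt) t x) y)
                  (from T-∧ (<⇒<ᵇ x<r , from T-∧ (<⇒<ᵇ y<r , from T-not (x≢y ∘ to T-==ᶠ)))))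
                (from T-==ᶠ fx≡fy))
    (λ d → from (T-all-allFin separatedAt) λ x → from (T-all-allFin (separated x)) λ y → from T-⇒ᵇ λ t →
       let (x<r , rest) = to T-∧ t ; (y<r , x≢y) = to T-∧ rest
       in from T-not λ fx≡fy → to T-not x≢y (from T-==ᶠ
            (d (<ᵇ⇒< (toℕ x) r x<r) (<ᵇ⇒< (toℕ y) r y<r) (to T-==ᶠ fx≡fy))))

  sound : T (isSPartitionᵇ f S r) → IsSPartition f S r
  sound t = let (su , rest₁) = to T-∧ t ; (ca , rest₂) = to T-∧ rest₁ ; (si , df) = to T-∧ rest₂ in
    record { surjective = to T-surjective su ; canonical = to T-canonical ca
           ; sizesIn = to (T-all-allFin _) si ; distinctFirst = to T-distinctFirst df }

  complete : IsSPartition f S r → T (isSPartitionᵇ f S r)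
  complete p = from T-∧ (from T-surjective (surjective p) , from T-∧ (from T-canonical (canonical p) ,
                 from T-∧ (from (T-all-allFin _) (sizesIn p) , from T-distinctFirst (distinctFirst p))))

blockSize-∑ : ∀ {m k} (f : Fun m k) j → blockSize f j ≡ ∑[ x ← allFin m ] ind (f x ==ᶠ j)
blockSize-∑ {m} f j = length-filterᵇ _ (allFin m)

blockSize-≗ : ∀ {m k} {f g : Fun m k} → f ≗ g → ∀ j → blockSize f j ≡ blockSize g j
blockSize-≗ {m} {f = f} {g} f≗g j = begin
  blockSize f j                        ≡⟨ blockSize-∑ f j ⟩
  ∑[ x ← allFin m ] ind (f x ==ᶠ j)    ≡⟨ ∑-cong (allFin m) (λ x → cong (λ t → ind (t ==ᶠ j)) (f≗g x)) ⟩
  ∑[ x ← allFin m ] ind (g x ==ᶠ j)    ≡⟨ sym (blockSize-∑ g j) ⟩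
  blockSize g j                        ∎
  where open ≡-Reasoning

term≤∑ : ∀ {k} (c : Fin k) (f : Fin k → ℕ) → f c ≤ ∑ (allFin k) f
term≤∑ zero    f = subst (f zero ≤_) (sym (∑-allFin-suc f)) (m≤m+n (f zero) _)
term≤∑ (suc c) f =
  subst (f (suc c) ≤_) (sym (∑-allFin-suc f)) (≤-trans (term≤∑ c (f ∘ suc)) (m≤n+m _ (f zero)))

blockSize-used : ∀ {m k} (f : Fun m k) {x j} → f x ≡ j → 1 ≤ blockSize f j
blockSize-used {m} f {x} {j} fx≡j = subst (1 ≤_) (sym (blockSize-∑ f j))
  (≤-trans (≤-reflexive (sym (ind-true (from T-==ᶠ fx≡j)))) (term≤∑ x (λ y → ind (f y ==ᶠ j))))

blockSize-unused : ∀ {m k} (f : Fun m k) {j} → (∀ x → f x ≢ j) → blockSize f j ≡ 0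
blockSize-unused {m} f {j} miss =
  trans (blockSize-∑ f j) (∑-vanish (allFin m) (λ x → ind-false (miss x ∘ to T-==ᶠ)))

blockSize-factor : ∀ {n i r} {h : Fun n r} {g : Fun n i} {ι : Fun i r} →
                   Injective _≡_ _≡_ ι → h ≗ ι ∘ g → ∀ k → blockSize h (ι k) ≡ blockSize g k
blockSize-factor {n} {h = h} {g} {ι} inj h≗ιg k = begin
  blockSize h (ι k)                        ≡⟨ blockSize-∑ h (ι k) ⟩
  ∑[ x ← allFin n ] ind (h x ==ᶠ ι k)      ≡⟨ ∑-cong (allFin n) (λ x → cong ind (T-ext (to-g x) (to-h x))) ⟩
  ∑[ x ← allFin n ] ind (g x ==ᶠ k)        ≡⟨ sym (blockSize-∑ g k) ⟩
  blockSize g k                            ∎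
  where
  open ≡-Reasoning
  to-g : ∀ x → T (h x ==ᶠ ι k) → T (g x ==ᶠ k)
  to-g x t = from T-==ᶠ (inj (trans (sym (h≗ιg x)) (to T-==ᶠ t)))
  to-h : ∀ x → T (g x ==ᶠ k) → T (h x ==ᶠ ι k)
  to-h x t = from T-==ᶠ (trans (h≗ιg x) (cong ι (to T-==ᶠ t)))

module _ {m k : ℕ} {f g : Fun m k} (f≗g : f ≗ g) where

  Surjective-≗ : Surjective f → Surjective g
  Surjective-≗ surj j = let (x , fx≡j) = surj j in x , trans (sym (f≗g x)) fx≡j

  Canonical-≗ : Canonical f → Canonical g
  Canonical-≗ can x j j< =
    let (y , y<x , fy≡j) = can x j (subst (λ t → toℕ j < toℕ t) (sym (f≗g x)) j<)
    in y , y<x , trans (sym (f≗g y)) fy≡j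

  IsSPartition-≗ : ∀ {S r} → IsSPartition f S r → IsSPartition g S r
  IsSPartition-≗ {S} P = record
    { surjective    = Surjective-≗ surjective
    ; canonical     = Canonical-≗ canonical
    ; sizesIn       = λ j → subst (T ∘ S) (blockSize-≗ f≗g j) (sizesIn j)
    ; distinctFirst = λ x<r y<r gx≡gy → distinctFirst x<r y<r (trans (f≗g _) (trans gx≡gy (sym (f≗g _))))
    }
    where open IsSPartition P

not-above : ∀ {m i i′} (g : Fun m i) (g′ : Fun m i′) → Canonical g′ → (∀ {x y} → g x ≡ g y → g′ x ≡ g′ y) →
            ∀ {x} → (∀ y → toℕ y < toℕ x → toℕ (g y) ≡ toℕ (g′ y)) → ¬ (toℕ (g x) < toℕ (g′ x))
not-above {i′ = i′} g g′ can′ ker {x} agree gx<g′x =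
  let (y , y<x , g′y≡j) = first-use
      -- g agrees with g′ at y, so y lies in the block of x for g, hence for g′
      gy≡gx = toℕ-injective (trans (agree y y<x) (trans (cong toℕ g′y≡j) (toℕ-fromℕ< gx<i′)))
  in <-irrefl (trans (sym (toℕ-fromℕ< gx<i′)) (trans (cong toℕ (sym g′y≡j)) (cong toℕ (ker gy≡gx)))) gx<g′x
  where
  gx<i′ : toℕ (g x) < i′
  gx<i′ = <-trans gx<g′x (toℕ<n (g′ x))
  first-use : ∃ λ y → toℕ y < toℕ x × g′ y ≡ fromℕ< gx<i′
  first-use = can′ x (fromℕ< gx<i′) (subst (_< toℕ (g′ x)) (sym (toℕ-fromℕ< gx<i′)) gx<g′x)

-- Two canonical labellings with the same kernel assign the same label numbers:
-- a set partition has only one canonical labelling.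
canonical-unique : ∀ {m i i′} (g : Fun m i) (g′ : Fun m i′) → Canonical g → Canonical g′ →
                   (∀ {x y} → g x ≡ g y → g′ x ≡ g′ y) → (∀ {x y} → g′ x ≡ g′ y → g x ≡ g y) →
                   ∀ x → toℕ (g x) ≡ toℕ (g′ x)
canonical-unique g g′ can can′ ker ker′ x = agree x (<-wellFounded x)
  where
  agree : ∀ x → Acc Fin._<_ x → toℕ (g x) ≡ toℕ (g′ x)
  agree x (acc below) = ≤-antisym
    (≮⇒≥ (not-above g′ g can ker′ (λ y y<x → sym (agree y (below y<x)))))
    (≮⇒≥ (not-above g g′ can′ ker (λ y y<x → agree y (below y<x))))

-- h = ι ∘ g where g is a canonical surjection onto Fin i (it labels the partition of the domain
-- into the non-empty fibres of h) and ι is injective (it records the value of h on each fibre).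
record IsFactorization {n i r} (h : Fun n r) (g : Fun n i) (ι : Fun i r) : Set where
  field
    surjective : Surjective g
    canonical  : Canonical g
    injective  : Injective _≡_ _≡_ ι
    factors    : h ≗ ι ∘ g

record Factorization {n r} (h : Fun n r) : Set where
  field
    size            : ℕ
    blocks          : Fun n size
    labels          : Fun size r
    isFactorization : IsFactorization h blocks labels

data SnocView : ∀ {n} → Fin (suc n) → Set where
  old : ∀ {n} (y : Fin n) → SnocView (inject₁ y)
  new : ∀ {n} → SnocView (fromℕ n)

snocView : ∀ {n} (x : Fin (suc n)) → SnocView x
snocView {zero}  zero    = new
snocView {suc n} zero    = old zero
snocView {suc n} (suc x) with snocView x
... | old y = old (suc y)
... | new   = new

old<new : ∀ {n} (y : Fin n) → toℕ (inject₁ y) < toℕ (fromℕ n)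
old<new {n} y = subst₂ _<_ (sym (toℕ-inject₁ y)) (sym (toℕ-fromℕ n)) (toℕ<n y)

below-new : ∀ {n} (x : Fin (suc n)) → toℕ x < toℕ (fromℕ n) → ∃ λ y → x ≡ inject₁ y
below-new x x<n with snocView x
... | old y = y , refl
... | new   = ⊥-elim (<-irrefl refl x<n)

_▷_ : ∀ {n} {A : Set} → (Fin n → A) → A → Fin (suc n) → A
_▷_ {zero}  f a zero    = a
_▷_ {suc n} f a zero    = f zero
_▷_ {suc n} f a (suc x) = ((f ∘ suc) ▷ a) x

▷-old : ∀ {n} {A : Set} (f : Fin n → A) a y → (f ▷ a) (inject₁ y) ≡ f y
▷-old {suc n} f a zero    = refl
▷-old {suc n} f a (suc y) = ▷-old (f ∘ suc) a y

▷-new : ∀ {n} {A : Set} (f : Fin n → A) a → (f ▷ a) (fromℕ n) ≡ a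
▷-new {zero}  f a = refl
▷-new {suc n} f a = ▷-new (f ∘ suc) a

▷-canonical : ∀ {n k} (G : Fun n k) (c : Fin k) → Canonical G →
              (∀ j → toℕ j < toℕ c → ∃ λ y → G y ≡ j) → Canonical (G ▷ c)
▷-canonical G c can used x j j< with snocView x
... | new   = let (y , Gy≡j) = used j (subst (λ t → toℕ j < toℕ t) (▷-new G c) j<)
              in inject₁ y , old<new y , trans (▷-old G c y) Gy≡j
... | old z = let (y , y<z , Gy≡j) = can z j (subst (λ t → toℕ j < toℕ t) (▷-old G c z) j<)
              in inject₁ y , subst₂ _<_ (sym (toℕ-inject₁ y)) (sym (toℕ-inject₁ z)) y<z ,
                 trans (▷-old G c y) Gy≡j

inject₁-canonical : ∀ {n i} (g : Fun n i) → Canonical g → Canonical (inject₁ ∘ g)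
inject₁-canonical g can x j j< =
  let (j′ , j≡) = below-new j (<-trans j<gx (subst (toℕ (g x) <_) (sym (toℕ-fromℕ _)) (toℕ<n (g x))))
      (y , y<x , gy≡j′) = can x j′ (subst (_< toℕ (g x)) (trans (cong toℕ j≡) (toℕ-inject₁ j′)) j<gx)
  in y , y<x , trans (cong inject₁ gy≡j′) (sym j≡)
  where
  j<gx : toℕ j < toℕ (g x)
  j<gx = subst (toℕ j <_) (toℕ-inject₁ (g x)) j<

factorization-join : ∀ {n i r} {h : Fun (suc n) r} {g : Fun n i} {ι : Fun i r} (k : Fin i) →
                     IsFactorization (h ∘ inject₁) g ι → ι k ≡ h (fromℕ n) → IsFactorization h (g ▷ k) ι
factorization-join {n} {h = h} {g} {ι} k F ιk≡hn = record
  { surjective = λ j → let (y , gy≡j) = surjective j in inject₁ y , trans (▷-old g k y) gy≡j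
  ; canonical  = ▷-canonical g k canonical (λ j _ → surjective j)
  ; injective  = injective
  ; factors    = factors′
  }
  where
  open IsFactorization F
  factors′ : h ≗ ι ∘ (g ▷ k)
  factors′ x with snocView x
  ... | new   = trans (sym ιk≡hn) (cong ι (sym (▷-new g k)))
  ... | old y = trans (factors y) (cong ι (sym (▷-old g k y)))

factorization-open : ∀ {n i r} {h : Fun (suc n) r} {g : Fun n i} {ι : Fun i r} →
                     IsFactorization (h ∘ inject₁) g ι → (∀ k → ι k ≢ h (fromℕ n)) →
                     IsFactorization h ((inject₁ ∘ g) ▷ fromℕ i) (ι ▷ h (fromℕ n))
factorization-open {n} {i} {r} {h} {g} {ι} F miss = record
  { surjective = surjective′
  ; canonical  = ▷-canonical (inject₁ ∘ g) (fromℕ i) (inject₁-canonical g canonical) used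
  ; injective  = injective′
  ; factors    = factors′
  }
  where
  open IsFactorization F
  g′ : Fun (suc n) (suc i)
  g′ = (inject₁ ∘ g) ▷ fromℕ i
  ι′ : Fun (suc i) r
  ι′ = ι ▷ h (fromℕ n)
  used : ∀ j → toℕ j < toℕ (fromℕ i) → ∃ λ y → inject₁ (g y) ≡ j
  used j j< = let (j′ , j≡) = below-new j j< ; (y , gy≡j′) = surjective j′
              in y , trans (cong inject₁ gy≡j′) (sym j≡)
  surjective′ : Surjective g′
  surjective′ j with snocView j
  ... | new    = fromℕ n , ▷-new (inject₁ ∘ g) (fromℕ i)
  ... | old j′ = let (y , gy≡j′) = surjective j′
                 in inject₁ y , trans (▷-old (inject₁ ∘ g) (fromℕ i) y) (cong inject₁ gy≡j′)
  injective′ : Injective _≡_ _≡_ ι′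
  injective′ {x} {y} e with snocView x | snocView y
  ... | new    | new    = refl
  ... | new    | old y′ = ⊥-elim (miss y′ (sym (trans (sym (▷-new ι _)) (trans e (▷-old ι _ y′)))))
  ... | old x′ | new    = ⊥-elim (miss x′ (trans (sym (▷-old ι _ x′)) (trans e (▷-new ι _))))
  ... | old x′ | old y′ = cong inject₁ (injective (trans (sym (▷-old ι _ x′)) (trans e (▷-old ι _ y′))))
  factors′ : h ≗ ι′ ∘ g′
  factors′ x with snocView x
  ... | new   = trans (sym (▷-new ι _)) (cong ι′ (sym (▷-new (inject₁ ∘ g) (fromℕ i))))
  ... | old y = trans (factors y)
                      (trans (sym (▷-old ι _ (g y))) (cong ι′ (sym (▷-old (inject₁ ∘ g) (fromℕ i) y))))

factorize : ∀ {n r} (h : Fun n r) → Factorization h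
factorize {zero} h = record
  { size = 0 ; blocks = λ () ; labels = λ ()
  ; isFactorization = record { surjective = λ () ; canonical = λ () ; injective = λ { {()} } ; factors = λ () }
  }
factorize {suc n} h with factorize (h ∘ inject₁)
... | record { size = i ; blocks = g ; labels = ι ; isFactorization = F }
    with any? (λ k → ι k ≟ᶠ h (fromℕ n))
...   | yes (k , ιk≡hn) = record { size = i ; blocks = g ▷ k ; labels = ι
                                 ; isFactorization = factorization-join k F ιk≡hn }
...   | no new-value    = record { size = suc i ; blocks = (inject₁ ∘ g) ▷ fromℕ i ; labels = ι ▷ h (fromℕ n)
                                 ; isFactorization = factorization-open F (λ k e → new-value (k , e)) }

module _ {n r : ℕ} {h : Fun n r} where

  -- The blocks of any factorization are the fibres of h, so two factorizations have the same kernel …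
  kernel-⊆ : ∀ {i i′} {g : Fun n i} {ι : Fun i r} {g′ : Fun n i′} {ι′ : Fun i′ r} →
             IsFactorization h g ι → IsFactorization h g′ ι′ → ∀ {x y} → g x ≡ g y → g′ x ≡ g′ y
  kernel-⊆ {ι = ι} F F′ {x} {y} gx≡gy = IsFactorization.injective F′ (begin
    _  ≡⟨ sym (IsFactorization.factors F′ x) ⟩
    h x ≡⟨ IsFactorization.factors F x ⟩
    ι _ ≡⟨ cong ι gx≡gy ⟩
    ι _ ≡⟨ sym (IsFactorization.factors F y) ⟩
    h y ≡⟨ IsFactorization.factors F′ y ⟩
    _   ∎)
    where open ≡-Reasoning

  -- … and, both block-labellings being canonical, the same label numbers.
  factorization-labels : ∀ {i i′} {g : Fun n i} {ι : Fun i r} {g′ : Fun n i′} {ι′ : Fun i′ r} →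
                         IsFactorization h g ι → IsFactorization h g′ ι′ → ∀ x → toℕ (g x) ≡ toℕ (g′ x)
  factorization-labels {g = g} {g′ = g′} F F′ = canonical-unique g g′
    (IsFactorization.canonical F) (IsFactorization.canonical F′) (kernel-⊆ F F′) (kernel-⊆ F′ F)

surjective-bounded : ∀ {n i} (g : Fun n i) → Surjective g → ∀ {b} → (∀ x → toℕ (g x) < b) → i ≤ b
surjective-bounded {i = zero}  g surj bound = z≤n
surjective-bounded {i = suc i} g surj bound =
  let (x , gx≡i) = surj (fromℕ i) in subst (_< _) (trans (cong toℕ gx≡i) (toℕ-fromℕ i)) (bound x)

module _ {n r : ℕ} {h : Fun n r} where

  factorization-size-unique : ∀ {i i′} {g : Fun n i} {ι : Fun i r} {g′ : Fun n i′} {ι′ : Fun i′ r} →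
                              IsFactorization h g ι → IsFactorization h g′ ι′ → i ≡ i′
  factorization-size-unique {i} {i′} {g} {g′ = g′} F F′ = ≤-antisym
    (surjective-bounded g  (IsFactorization.surjective F)  (λ x → subst (_< i′) (sym (labels x)) (toℕ<n (g′ x))))
    (surjective-bounded g′ (IsFactorization.surjective F′) (λ x → subst (_< i) (labels x) (toℕ<n (g x))))
    where labels = factorization-labels F F′

  factorization-unique : ∀ {i} {g g′ : Fun n i} {ι ι′ : Fun i r} →
                         IsFactorization h g ι → IsFactorization h g′ ι′ → g ≗ g′ × ι ≗ ι′
  factorization-unique {g = g} {g′} {ι} {ι′} F F′ = same-blocks , same-labels
    where
    same-blocks : g ≗ g′
    same-blocks x = toℕ-injective (factorization-labels F F′ x)
    same-labels : ι ≗ ι′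
    same-labels k = let (x , gx≡k) = IsFactorization.surjective F k in begin
      ι k        ≡⟨ cong ι (sym gx≡k) ⟩
      ι (g x)    ≡⟨ sym (IsFactorization.factors F x) ⟩
      h x        ≡⟨ IsFactorization.factors F′ x ⟩
      ι′ (g′ x)  ≡⟨ cong ι′ (trans (sym (same-blocks x)) gx≡k) ⟩
      ι′ k       ∎
      where open ≡-Reasoning

  IsFactorization-≗ : ∀ {i} {g g′ : Fun n i} {ι ι′ : Fun i r} →
                      g ≗ g′ → ι ≗ ι′ → IsFactorization h g ι → IsFactorization h g′ ι′
  IsFactorization-≗ {g = g} {g′} {ι} {ι′} g≗g′ ι≗ι′ F = record
    { surjective = Surjective-≗ g≗g′ surjective
    ; canonical  = Canonical-≗ g≗g′ canonical
    ; injective  = λ {x} {y} e → injective (trans (ι≗ι′ x) (trans e (sym (ι≗ι′ y))))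
    ; factors    = λ x → trans (factors x) (trans (ι≗ι′ (g x)) (cong ι′ (g≗g′ x)))
    }
    where open IsFactorization F

injective-miss⇒< : ∀ {i r} {ι : Fun i r} {j : Fin r} → Injective _≡_ _≡_ ι → (∀ k → ι k ≢ j) → i < r
injective-miss⇒< {r = suc r} {ι} {j} inj miss =
  s≤s (injective⇒≤ {f = λ k → punchOut (miss k ∘ sym)}
                   (λ {x} {y} e → inj (punchOut-injective (miss x ∘ sym) (miss y ∘ sym) e)))

onto⇒≥ : ∀ {i r} {ι : Fun i r} → (∀ j → ∃ λ k → ι k ≡ j) → r ≤ i
onto⇒≥ {ι = ι} onto = injective⇒≤ {f = proj₁ ∘ onto}
  (λ {x} {y} e → trans (sym (proj₂ (onto x))) (trans (cong ι e) (proj₂ (onto y))))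

-- The maps h : Fin n → Fin r counted by {n brace 0}_{S,r} after removing 1, …, r: every fibre of h,
-- enlarged by one point, has size in S.
admissibleᵇ : SizeSet → ∀ {n r} → Fun n r → Bool
admissibleᵇ S {r = r} h = all (λ j → S (suc (blockSize h j))) (allFin r)

-- An injection Fin i → Fin r may leave points uncovered (i.e. h may have empty fibres, which
-- become singleton blocks) only if 1 ∈ S.
coverageᵇ : SizeSet → ℕ → ℕ → Bool
coverageᵇ S r i = S 1 ∨ (i ≡ᵇ r)

reduced : SizeSet → SizeSet
reduced S = shift (remove1 S)

T-reduced : ∀ (S : SizeSet) {t} → 1 ≤ t → T (reduced S t) ⇔ T (S (suc t))
T-reduced S {suc t} _ = mk⇔ (proj₁ ∘ to T-∧) (λ s → from T-∧ (s , _))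

factorization-admissible : ∀ (S : SizeSet) {n i r} {h : Fun n r} {g : Fun n i} {ι : Fun i r} →
                           IsFactorization h g ι →
                           T (admissibleᵇ S h) ⇔ (SizesIn g (reduced S) × T (coverageᵇ S r i))
factorization-admissible S {n} {i} {r} {h} {g} {ι} F = mk⇔
  (λ ad → let ad′ = to (T-all-allFin _) ad in blocks-allowed ad′ , coverage ad′)
  (λ (sizes , cov) → from (T-all-allFin _) (fibre-allowed sizes cov))
  where
  open IsFactorization F
  fibre-size : ∀ k → blockSize h (ι k) ≡ blockSize g k
  fibre-size = blockSize-factor injective factors
  block-nonempty : ∀ k → 1 ≤ blockSize g k
  block-nonempty k = blockSize-used g (proj₂ (surjective k))
  missed-empty : ∀ {j} → (∀ k → ι k ≢ j) → blockSize h j ≡ 0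
  missed-empty miss = blockSize-unused h (λ x hx≡j → miss (g x) (trans (sym (factors x)) hx≡j))

  blocks-allowed : (∀ j → T (S (suc (blockSize h j)))) → SizesIn g (reduced S)
  blocks-allowed ad k =
    from (T-reduced S (block-nonempty k)) (subst (T ∘ S ∘ suc) (fibre-size k) (ad (ι k)))

  coverage : (∀ j → T (S (suc (blockSize h j)))) → T (coverageᵇ S r i)
  coverage ad with T? (S 1)
  ... | yes s₁ = from T-∨ (inj₁ s₁)
  ... | no ¬s₁ = from T-∨ (inj₂ (≡⇒≡ᵇ i r (≤-antisym (injective⇒≤ injective) (onto⇒≥ onto))))
    where
    onto : ∀ j → ∃ λ k → ι k ≡ j
    onto j with any? (λ k → ι k ≟ᶠ j)
    ... | yes hit  = hit
    ... | no  miss = ⊥-elim (¬s₁ (subst (T ∘ S ∘ suc) (missed-empty (λ k e → miss (k , e))) (ad j)))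

  fibre-allowed : SizesIn g (reduced S) → T (coverageᵇ S r i) → ∀ j → T (S (suc (blockSize h j)))
  fibre-allowed sizes cov j with any? (λ k → ι k ≟ᶠ j)
  ... | yes (k , refl) =
    subst (T ∘ S ∘ suc) (sym (fibre-size k)) (to (T-reduced S (block-nonempty k)) (sizes k))
  ... | no  miss with to T-∨ cov
  ...   | inj₁ s₁  = subst (T ∘ S ∘ suc) (sym (missed-empty (λ k e → miss (k , e)))) s₁
  ...   | inj₂ i≡r = ⊥-elim (<-irrefl (≡ᵇ⇒≡ i r i≡r) (injective-miss⇒< injective (λ k e → miss (k , e))))

stirlingS-∑ : ∀ (S : SizeSet) n k → stirlingS S n k ≡ ∑[ g ← allFuns n k ] ind (isSPartitionᵇ g S 0)
stirlingS-∑ S n k = count (+-identityʳ n) (+-identityʳ k)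
  where
  count : ∀ {m l} → m ≡ n → l ≡ k → length (filterᵇ (λ g → isSPartitionᵇ g S 0) (allFuns m l))
                                     ≡ ∑[ g ← allFuns n k ] ind (isSPartitionᵇ g S 0)
  count refl refl = length-filterᵇ _ (allFuns n k)

rStirlingS-∑ : ∀ (S : SizeSet) r n → rStirlingS S r n 0 ≡ ∑[ f ← allFuns (r + n) r ] ind (isSPartitionᵇ f S r)
rStirlingS-∑ S r n = count (+-comm n r)
  where
  count : ∀ {m} → m ≡ r + n → length (filterᵇ (λ f → isSPartitionᵇ f S r) (allFuns m r))
                              ≡ ∑[ f ← allFuns (r + n) r ] ind (isSPartitionᵇ f S r)
  count refl = length-filterᵇ _ (allFuns (r + n) r)

∑Fac : ∀ n r → ((i : ℕ) → Fun n i → Fun i r → ℕ) → ℕ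
∑Fac n r W = ∑[ i ← upTo (suc r) ] ∑[ g ← allFuns n i ] ∑[ ι ← allFuns i r ] W i g ι

∑-∑Fac : ∀ (xs : List A) n r (W : A → (i : ℕ) → Fun n i → Fun i r → ℕ) →
         ∑[ x ← xs ] ∑Fac n r (W x) ≡ ∑Fac n r (λ i g ι → ∑[ x ← xs ] W x i g ι)
∑-∑Fac xs n r W =
  trans (∑-swap xs (upTo (suc r)) _) (∑-cong (upTo (suc r)) λ i →
  trans (∑-swap xs (allFuns n i) _) (∑-cong (allFuns n i) λ g →
  ∑-swap xs (allFuns i r) _))

module Counting (S : SizeSet) {n r : ℕ} where

  contribution : ℕ → ℕ
  contribution i = falling r i * stirlingS (reduced S) n i

  weightᵇ : Fun n r → (i : ℕ) → Fun n i → Fun i r → Bool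
  weightᵇ h i g ι = (coverageᵇ S r i ∧ isSPartitionᵇ g (reduced S) 0) ∧ (injectiveᵇ ι ∧ (h ≗ᵇ ι ∘ g))

  T-weight : ∀ h i g ι → T (weightᵇ h i g ι) ⇔ (IsFactorization h g ι × T (admissibleᵇ S h))
  T-weight h i g ι = mk⇔ sound complete
    where
    sound : T (weightᵇ h i g ι) → IsFactorization h g ι × T (admissibleᵇ S h)
    sound t =
      let (left , right) = to T-∧ t ; (cov , part) = to T-∧ left ; (inj , fac) = to T-∧ right
          P = to (T-isSPartitionᵇ g (reduced S) 0) part
          F = record { surjective = IsSPartition.surjective P ; canonical = IsSPartition.canonical P
                     ; injective = to T-injectiveᵇ inj ; factors = to T-≗ᵇ fac }
      in F , from (factorization-admissible S F) (IsSPartition.sizesIn P , cov)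
    complete : IsFactorization h g ι × T (admissibleᵇ S h) → T (weightᵇ h i g ι)
    complete (F , ad) =
      let open IsFactorization F
          (sizes , cov) = to (factorization-admissible S F) ad
          P = record { surjective = surjective ; canonical = canonical ; sizesIn = sizes ; distinctFirst = λ () }
      in from T-∧ (from T-∧ (cov , from (T-isSPartitionᵇ g (reduced S) 0) P) ,
                   from T-∧ (from T-injectiveᵇ injective , from T-≗ᵇ factors))

  -- For fixed h the weights add up to [h admissible], because the factorization of h is unique.
  ∑-weight-by-map : ∀ h → ∑Fac n r (λ i g ι → ind (weightᵇ h i g ι)) ≡ ind (admissibleᵇ S h)
  ∑-weight-by-map h =
    trans (∑-only-upTo (s≤s (injective⇒≤ (IsFactorization.injective F₀))) _ other-size) (begin
      ∑[ g ← allFuns n i₀ ] ∑[ ι ← allFuns i₀ r ] ind (weightᵇ h i₀ g ι)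
        ≡⟨ ∑-cong (allFuns n i₀) (λ g → ∑-unique ι₀ (admissibleᵇ S h ∧ (g ≗ᵇ g₀)) _ (sound g) (complete g)) ⟩
      ∑[ g ← allFuns n i₀ ] ind (admissibleᵇ S h ∧ (g ≗ᵇ g₀))
        ≡⟨ ∑-unique g₀ (admissibleᵇ S h) _ (λ g t → let (ad , e) = to T-∧ t in ad , to T-≗ᵇ e)
                                           (λ ad g e → from T-∧ (ad , from T-≗ᵇ e)) ⟩
      ind (admissibleᵇ S h) ∎)
    where
    open ≡-Reasoning
    open Factorization (factorize h) renaming (size to i₀; blocks to g₀; labels to ι₀; isFactorization to F₀)
    other-size : ∀ i → i ≢ i₀ → ∑[ g ← allFuns n i ] ∑[ ι ← allFuns i r ] ind (weightᵇ h i g ι) ≡ 0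
    other-size i i≢i₀ = ∑-vanish (allFuns n i) λ g → ∑-vanish (allFuns i r) λ ι →
      ind-false (λ t → i≢i₀ (factorization-size-unique (proj₁ (to (T-weight h i g ι) t)) F₀))
    sound : ∀ g ι → T (weightᵇ h i₀ g ι) → T (admissibleᵇ S h ∧ (g ≗ᵇ g₀)) × ι ≗ ι₀
    sound g ι t = let (F , ad) = to (T-weight h i₀ g ι) t ; (g≗g₀ , ι≗ι₀) = factorization-unique F F₀
                  in from T-∧ (ad , from T-≗ᵇ g≗g₀) , ι≗ι₀
    complete : ∀ g → T (admissibleᵇ S h ∧ (g ≗ᵇ g₀)) → ∀ ι → ι ≗ ι₀ → T (weightᵇ h i₀ g ι)
    complete g t ι ι≗ι₀ = let (ad , e) = to T-∧ t in
      from (T-weight h i₀ g ι) (IsFactorization-≗ (sym ∘ to T-≗ᵇ e) (sym ∘ ι≗ι₀) F₀ , ad)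

  -- For fixed (i, g, ι) exactly one h, namely ι ∘ g, can have weight 1.
  ∑-weight-by-factorization : ∀ i g ι →
    ∑[ h ← allFuns n r ] ind (weightᵇ h i g ι)
    ≡ ind (coverageᵇ S r i ∧ isSPartitionᵇ g (reduced S) 0) * ind (injectiveᵇ ι)
  ∑-weight-by-factorization i g ι = begin
    ∑[ h ← allFuns n r ] ind (weightᵇ h i g ι)
      ≡⟨ ∑-cong (allFuns n r) (λ h → trans (ind-∧ a _) (cong (ind a *_) (ind-∧ b _))) ⟩
    ∑[ h ← allFuns n r ] (ind a * (ind b * ind (h ≗ᵇ ι ∘ g)))
      ≡⟨ trans (∑-*ˡ (allFuns n r) (ind a) _) (cong (ind a *_) (∑-*ˡ (allFuns n r) (ind b) _)) ⟩
    ind a * (ind b * ∑[ h ← allFuns n r ] ind (h ≗ᵇ ι ∘ g))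
      ≡⟨ cong (λ t → ind a * (ind b * t)) (∑-≗ᵇ n r (ι ∘ g)) ⟩
    ind a * (ind b * 1)
      ≡⟨ cong (ind a *_) (*-identityʳ (ind b)) ⟩
    ind a * ind b ∎
    where
    open ≡-Reasoning
    a b : Bool
    a = coverageᵇ S r i ∧ isSPartitionᵇ g (reduced S) 0
    b = injectiveᵇ ι

  ∑-weight-by-size : ∀ i → ∑[ g ← allFuns n i ] ∑[ ι ← allFuns i r ] ∑[ h ← allFuns n r ] ind (weightᵇ h i g ι)
                           ≡ ind (coverageᵇ S r i) * contribution i
  ∑-weight-by-size i = begin
    ∑[ g ← allFuns n i ] ∑[ ι ← allFuns i r ] ∑[ h ← allFuns n r ] ind (weightᵇ h i g ι)
      ≡⟨ ∑-cong (allFuns n i) (λ g → trans (∑-cong (allFuns i r) (∑-weight-by-factorization i g))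
                                           (∑-*ˡ (allFuns i r) (ind (valid g)) (ind ∘ injectiveᵇ))) ⟩
    ∑[ g ← allFuns n i ] (ind (valid g) * ∑ (allFuns i r) (ind ∘ injectiveᵇ))
      ≡⟨ ∑-*ʳ (allFuns n i) _ (ind ∘ valid) ⟩
    ∑[ g ← allFuns n i ] ind (valid g) * ∑ (allFuns i r) (ind ∘ injectiveᵇ)
      ≡⟨ cong₂ _*_ partitions (count-injections i r) ⟩
    ind cov * stirlingS (reduced S) n i * falling r i
      ≡⟨ *-assoc (ind cov) _ (falling r i) ⟩
    ind cov * (stirlingS (reduced S) n i * falling r i)
      ≡⟨ cong (ind cov *_) (*-comm (stirlingS (reduced S) n i) (falling r i)) ⟩
    ind cov * contribution i ∎
    where
    open ≡-Reasoning
    cov : Bool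
    cov = coverageᵇ S r i
    valid : Fun n i → Bool
    valid g = cov ∧ isSPartitionᵇ g (reduced S) 0
    partitions : ∑[ g ← allFuns n i ] ind (valid g) ≡ ind cov * stirlingS (reduced S) n i
    partitions = begin
      ∑[ g ← allFuns n i ] ind (valid g)
        ≡⟨ ∑-cong (allFuns n i) (λ g → ind-∧ cov _) ⟩
      ∑[ g ← allFuns n i ] (ind cov * ind (isSPartitionᵇ g (reduced S) 0))
        ≡⟨ ∑-*ˡ (allFuns n i) (ind cov) _ ⟩
      ind cov * ∑[ g ← allFuns n i ] ind (isSPartitionᵇ g (reduced S) 0)
        ≡⟨ cong (ind cov *_) (sym (stirlingS-∑ (reduced S) n i)) ⟩
      ind cov * stirlingS (reduced S) n i ∎

  count-admissible : ∑ (allFuns n r) (ind ∘ admissibleᵇ S)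
                     ≡ ∑[ i ← upTo (suc r) ] (ind (coverageᵇ S r i) * contribution i)
  count-admissible = begin
    ∑ (allFuns n r) (ind ∘ admissibleᵇ S)
      ≡⟨ ∑-cong (allFuns n r) (sym ∘ ∑-weight-by-map) ⟩
    ∑[ h ← allFuns n r ] ∑Fac n r (λ i g ι → ind (weightᵇ h i g ι))
      ≡⟨ ∑-∑Fac (allFuns n r) n r (λ h i g ι → ind (weightᵇ h i g ι)) ⟩
    ∑Fac n r (λ i g ι → ∑[ h ← allFuns n r ] ind (weightᵇ h i g ι))
      ≡⟨ ∑-cong (upTo (suc r)) ∑-weight-by-size ⟩
    ∑[ i ← upTo (suc r) ] (ind (coverageᵇ S r i) * contribution i) ∎
    where open ≡-Reasoning

data SplitView (r n : ℕ) : Fin (r + n) → Set where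
  first : (y : Fin r) → SplitView r n (y ↑ˡ n)
  rest  : (z : Fin n) → SplitView r n (r ↑ʳ z)

splitView : ∀ r n (x : Fin (r + n)) → SplitView r n x
splitView zero    n x       = rest x
splitView (suc r) n zero    = first zero
splitView (suc r) n (suc x) with splitView r n x
... | first y = first (suc y)
... | rest  z = rest z

first<r : ∀ {r} n (y : Fin r) → toℕ (y ↑ˡ n) < r
first<r n y = subst (_< _) (sym (toℕ-↑ˡ y n)) (toℕ<n y)

below-r : ∀ {r n} (x : Fin (r + n)) → toℕ x < r → ∃ λ y → x ≡ y ↑ˡ n
below-r {r} {n} x x<r with splitView r n x
... | first y = y , refl
... | rest  z = ⊥-elim (<⇒≱ x<r (subst (r ≤_) (sym (toℕ-↑ʳ r z)) (m≤m+n r (toℕ z))))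

-- The r-partition of [r + n] attached to h : Fin n → Fin r: the point y < r forms block y,
-- and the point r + z joins block h z.
embed : ∀ {n r} → Fun n r → Fun (r + n) r
embed {r = r} h x = [ id , h ]′ (splitAt r x)

embed-↑ˡ : ∀ {n r} (h : Fun n r) y → embed h (y ↑ˡ n) ≡ y
embed-↑ˡ {n} {r} h y rewrite splitAt-↑ˡ r y n = refl

embed-↑ʳ : ∀ {n r} (h : Fun n r) z → embed h (r ↑ʳ z) ≡ h z
embed-↑ʳ {n} {r} h z rewrite splitAt-↑ʳ r n z = refl

embed-≗ : ∀ {n r} {h h′ : Fun n r} → h ≗ h′ → embed h ≗ embed h′
embed-≗ {n} {r} {h} {h′} h≗h′ x with splitView r n x
... | first y = trans (embed-↑ˡ h y) (sym (embed-↑ˡ h′ y))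
... | rest  z = trans (embed-↑ʳ h z) (trans (h≗h′ z) (sym (embed-↑ʳ h′ z)))

-- Each block of embed h is a block of h enlarged by one of the first r points.
blockSize-embed : ∀ {n r} (h : Fun n r) j → blockSize (embed h) j ≡ suc (blockSize h j)
blockSize-embed {n} {r} h j = begin
  blockSize (embed h) j
    ≡⟨ blockSize-∑ (embed h) j ⟩
  ∑[ x ← allFin (r + n) ] ind (embed h x ==ᶠ j)
    ≡⟨ ∑-allFin-+ r n _ ⟩
  ∑[ y ← allFin r ] ind (embed h (y ↑ˡ n) ==ᶠ j) + ∑[ z ← allFin n ] ind (embed h (r ↑ʳ z) ==ᶠ j)
    ≡⟨ cong₂ _+_ (∑-point j _ (λ y → mk⇔ (λ t → trans (sym (embed-↑ˡ h y)) (to T-==ᶠ t))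
                                         (λ y≡j → from T-==ᶠ (trans (embed-↑ˡ h y) y≡j))))
                 (∑-cong (allFin n) (λ z → cong (λ t → ind (t ==ᶠ j)) (embed-↑ʳ h z))) ⟩
  suc (∑[ z ← allFin n ] ind (h z ==ᶠ j))
    ≡⟨ cong suc (sym (blockSize-∑ h j)) ⟩
  suc (blockSize h j) ∎
  where open ≡-Reasoning

-- A canonical labelling of Fin (r + n) putting the first r points in distinct blocks gives
-- the point y < r the label y: restricted to these points it is canonical and injective, as is id.
fixes-first : ∀ {r n} {f : Fun (r + n) r} → Canonical f → DistinctFirst f r → ∀ y → f (y ↑ˡ n) ≡ y
fixes-first {r} {n} {f} canonical distinctFirst y = toℕ-injective
  (canonical-unique (f ∘ (_↑ˡ n)) id prefix-canonical (λ x j j< → j , j< , refl)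
                    prefix-injective (cong (f ∘ (_↑ˡ n))) y)
  where
  prefix-canonical : Canonical (f ∘ (_↑ˡ n))
  prefix-canonical x j j< =
    let (y , y<x , fy≡j) = canonical (x ↑ˡ n) j j<
        (y′ , y≡) = below-r y (<-trans y<x (first<r n x))
    in y′ , subst₂ _<_ (trans (cong toℕ y≡) (toℕ-↑ˡ y′ n)) (toℕ-↑ˡ x n) y<x , trans (cong f (sym y≡)) fy≡j
  prefix-injective : ∀ {x y} → f (x ↑ˡ n) ≡ f (y ↑ˡ n) → x ≡ y
  prefix-injective {x} {y} e = ↑ˡ-injective n x y (distinctFirst (first<r n x) (first<r n y) e)

module _ (S : SizeSet) {n r : ℕ} where

  embed-isSPartition : ∀ (h : Fun n r) → IsSPartition (embed h) S r ⇔ T (admissibleᵇ S h)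
  embed-isSPartition h = mk⇔
    (λ P → from (T-all-allFin _) λ j → subst (T ∘ S) (blockSize-embed h j) (IsSPartition.sizesIn P j))
    (λ ad → record
      { surjective    = λ j → j ↑ˡ n , embed-↑ˡ h j
      ; canonical     = canonical
      ; sizesIn       = λ j → subst (T ∘ S) (sym (blockSize-embed h j)) (to (T-all-allFin _) ad j)
      ; distinctFirst = distinctFirst
      })
    where
    canonical : Canonical (embed h)
    canonical x j j< = j ↑ˡ n , first-use , embed-↑ˡ h j
      where
      first-use : toℕ (j ↑ˡ n) < toℕ x
      first-use with splitView r n x
      ... | first y = subst₂ _<_ (sym (toℕ-↑ˡ j n)) (sym (toℕ-↑ˡ y n))
                             (subst (λ t → toℕ j < toℕ t) (embed-↑ˡ h y) j<)
      ... | rest  z = subst₂ _<_ (sym (toℕ-↑ˡ j n)) (sym (toℕ-↑ʳ r z)) (≤-trans (toℕ<n j) (m≤m+n r (toℕ z)))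
    distinctFirst : DistinctFirst (embed h) r
    distinctFirst {x} {y} x<r y<r e with below-r x x<r | below-r y y<r
    ... | x′ , refl | y′ , refl = cong (_↑ˡ n) (trans (sym (embed-↑ˡ h x′)) (trans e (embed-↑ˡ h y′)))

  isSPartition-embed : ∀ {f : Fun (r + n) r} → IsSPartition f S r → f ≗ embed (f ∘ (r ↑ʳ_))
  isSPartition-embed {f} P x with splitView r n x
  ... | first y = trans (fixes-first (IsSPartition.canonical P) (IsSPartition.distinctFirst P) y)
                        (sym (embed-↑ˡ (f ∘ (r ↑ʳ_)) y))
  ... | rest  z = sym (embed-↑ʳ (f ∘ (r ↑ʳ_)) z)

  count-rPartitions : ∑[ f ← allFuns (r + n) r ] ind (isSPartitionᵇ f S r)
                      ≡ ∑ (allFuns n r) (ind ∘ admissibleᵇ S)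
  count-rPartitions = begin
    ∑[ f ← allFuns (r + n) r ] ind (isSPartitionᵇ f S r)
      ≡⟨ ∑-cong (allFuns (r + n) r) (λ f → sym (∑-unique (f ∘ (r ↑ʳ_)) (isSPartitionᵇ f S r) (related f)
                                                          (restriction f) (extension f))) ⟩
    ∑[ f ← allFuns (r + n) r ] ∑[ h ← allFuns n r ] ind (related f h)
      ≡⟨ ∑-swap (allFuns (r + n) r) (allFuns n r) _ ⟩
    ∑[ h ← allFuns n r ] ∑[ f ← allFuns (r + n) r ] ind (related f h)
      ≡⟨ ∑-cong (allFuns n r) (λ h → ∑-unique (embed h) (admissibleᵇ S h) (λ f → related f h)
                                       (λ f t → let (ad , e) = to T-∧ t in ad , to T-≗ᵇ e)
                                       (λ ad f e → from T-∧ (ad , from T-≗ᵇ e))) ⟩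
    ∑ (allFuns n r) (ind ∘ admissibleᵇ S) ∎
    where
    open ≡-Reasoning
    related : Fun (r + n) r → Fun n r → Bool
    related f h = admissibleᵇ S h ∧ (f ≗ᵇ embed h)
    restriction : ∀ f h → T (related f h) → T (isSPartitionᵇ f S r) × h ≗ f ∘ (r ↑ʳ_)
    restriction f h t =
      let (ad , e) = to T-∧ t ; f≗ = to T-≗ᵇ e
      in from (T-isSPartitionᵇ f S r) (IsSPartition-≗ (sym ∘ f≗) (from (embed-isSPartition h) ad)) ,
         λ z → trans (sym (embed-↑ʳ h z)) (sym (f≗ (r ↑ʳ z)))
    extension : ∀ f → T (isSPartitionᵇ f S r) → ∀ h → h ≗ f ∘ (r ↑ʳ_) → T (related f h)
    extension f t h h≗ =
      let P = to (T-isSPartitionᵇ f S r) t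
          f≗ = λ x → trans (isSPartition-embed P x) (embed-≗ (sym ∘ h≗) x)
      in from T-∧ (to (embed-isSPartition h) (IsSPartition-≗ f≗ P) , from T-≗ᵇ f≗)

falling-suc : ∀ r i → falling (suc r) (suc i) ≡ suc r * falling r i
falling-suc r zero    = trans (*-identityˡ (suc r)) (sym (*-identityʳ (suc r)))
falling-suc r (suc i) = begin
  falling (suc r) (suc i) * (r ∸ i)   ≡⟨ cong (_* (r ∸ i)) (falling-suc r i) ⟩
  suc r * falling r i * (r ∸ i)       ≡⟨ *-assoc (suc r) (falling r i) (r ∸ i) ⟩
  suc r * (falling r i * (r ∸ i))     ∎
  where open ≡-Reasoning

falling-self : ∀ r → falling r r ≡ r !
falling-self zero    = refl
falling-self (suc r) = trans (falling-suc r r) (cong (suc r *_) (falling-self r))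

stirlingS-cong : ∀ {A B : SizeSet} → (∀ t → A t ≡ B t) → ∀ n k → stirlingS A n k ≡ stirlingS B n k
stirlingS-cong {A} {B} A≗B n k = begin
  stirlingS A n k                                   ≡⟨ stirlingS-∑ A n k ⟩
  ∑[ g ← allFuns n k ] ind (isSPartitionᵇ g A 0)    ≡⟨ ∑-cong (allFuns n k) (cong ind ∘ same-test) ⟩
  ∑[ g ← allFuns n k ] ind (isSPartitionᵇ g B 0)    ≡⟨ sym (stirlingS-∑ B n k) ⟩
  stirlingS B n k                                   ∎
  where
  open ≡-Reasoning
  same-test : ∀ g → isSPartitionᵇ g A 0 ≡ isSPartitionᵇ g B 0
  same-test g = cong (λ sizes → surjectiveᵇ g ∧ canonicalᵇ g ∧ sizes ∧ distinctFirstᵇ g 0)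
                     (cong and (map-cong (λ j → A≗B (blockSize g j)) (allFin k)))

mainTheorem5 : (S : SizeSet) → S 0 ≡ false → (n r : ℕ) →
    (S 1 ≡ false → rStirlingS S r n 0 ≡ r ! * stirlingS (shift S) n r)
    × (S 1 ≡ true → rStirlingS S r n 0 ≡ sum (map (λ i → falling r i * stirlingS (shift (remove1 S)) n i) (upTo (suc r))))
mainTheorem5 S _ n r = without-singletons , with-singletons
  where
  open Counting S {n} {r}

  reduction : rStirlingS S r n 0 ≡ ∑[ i ← upTo (suc r) ] (ind (coverageᵇ S r i) * contribution i)
  reduction = trans (rStirlingS-∑ S r n) (trans (count-rPartitions S {n} {r}) count-admissible)

  with-singletons : S 1 ≡ true → rStirlingS S r n 0 ≡ ∑ (upTo (suc r)) contribution
  with-singletons s₁ = trans reduction (∑-cong (upTo (suc r)) λ i →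
    trans (cong (λ b → ind (b ∨ (i ≡ᵇ r)) * contribution i) s₁) (*-identityˡ (contribution i)))

  without-singletons : S 1 ≡ false → rStirlingS S r n 0 ≡ r ! * stirlingS (shift S) n r
  without-singletons s₁ = begin
    rStirlingS S r n 0                                                ≡⟨ reduction ⟩
    ∑[ i ← upTo (suc r) ] (ind (coverageᵇ S r i) * contribution i)    ≡⟨ ∑-only-upTo (n<1+n r) _ only-r ⟩
    ind (coverageᵇ S r r) * contribution r                            ≡⟨ cong (_* contribution r) covered ⟩
    1 * contribution r                                                ≡⟨ *-identityˡ (contribution r) ⟩
    falling r r * stirlingS (reduced S) n r                           ≡⟨ cong₂ _*_ (falling-self r)
                                                                           (stirlingS-cong no-singletons n r) ⟩
    r ! * stirlingS (shift S) n r                                     ∎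
    where
    open ≡-Reasoning
    -- without singleton blocks, the fibres of h must all be non-empty: only i = r contributes
    only-r : ∀ i → i ≢ r → ind (coverageᵇ S r i) * contribution i ≡ 0
    only-r i i≢r = cong (_* contribution i) (ind-false λ t → case-split (to T-∨ t))
      where
      case-split : T (S 1) ⊎ T (i ≡ᵇ r) → ⊥
      case-split (inj₁ s) = subst T s₁ s
      case-split (inj₂ e) = i≢r (≡ᵇ⇒≡ i r e)
    covered : ind (coverageᵇ S r r) ≡ 1
    covered = ind-true {coverageᵇ S r r} (from T-∨ (inj₂ (≡⇒≡ᵇ r r refl)))
    no-singletons : ∀ t → reduced S t ≡ shift S t
    no-singletons zero    = trans (∧-zeroʳ (S 1)) (sym s₁)
    no-singletons (suc t) = ∧-identityʳ (S (suc (suc t)))
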